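{- Let $P$ be a decreasing tableau such that $\mathrm{row}(P)$ is reduced, let $(r,c)$ be a removable cell of $P$, and let $\Psi(P,(r,c),1)=(P',m)$. Then applying Edelman–Greene reverse row insertion at $(r,c)$ in $P$ also yields $(P',m)$.
   Context: Tableaux use English notation; cell $(i,j)$ is in row $i$, column $j$. A decreasing tableau is a filling of the diagram of a partition by positive integers strictly decreasing from left to right along rows and from top to bottom along columns. A cell is removable if it is the last cell of its row and the bottom cell of its column. $P_{>r}$ denotes the tableau obtained by deleting the first $r$ rows of $P$ (rows renumbered from 1). The row word $\mathrm{row}(P)$ is $\cdots u^{(2)}u^{(1)}$, where $u^{(j)}$ is row $j$ read left to right. Hecke equivalence $\equiv_H$ is the congruence on words in $\mathbb{Z}_{>0}$ generated by $jj\equiv_H j$, $j(j+1)j\equiv_H(j+1)j(j+1)$, $jk\equiv_H kj$ ($|j-k|\ge2$); a word is reduced if it has minimal length in its $\equiv_H$ class (equivalently it is a reduced word of a permutation). A value $x$ is $P$-ejectable if $x$ occurs in the first row of $P$ and either $x-1$ does not occur in the first row, or $x-1$ occurs in the first row and $x-1$ is $P_{>1}$-ejectable (nothing is ejectable in the empty tableau). Bumping path of a removable cell $(r,c)$ of $P$: $m_r$ is the entry at $(r,c)$, and for $i=r-1,\dots,1$, $m_i$ is the smallest entry of row $i$ with $m_i>m_{i+1}$. Edelman–Greene reverse row insertion at $(r,c)$ in $P$: compute the bumping path $m_r<\dots<m_1$, delete the cell $(r,c)$, and for $i=r-1,\dots,1$: if $m_i-1$ is an entry of row $i$ of $P$,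 leave row $i$ unchanged; otherwise replace $m_i$ in row $i$ by $m_{i+1}$. Output the resulting tableau and $m_1$. Reverse insertion $\Psi(P,(r,c),\alpha)=(P',m)$: compute the bumping path; set $m:=m_1$, $P':=P$. If $\alpha=1$, delete cell $(r,c)$ from $P'$, set $\alpha_r=1$, and process rows $i=r-1,\dots,1$. If $\alpha=0$, set $m_{r+1}=0$, $\alpha_{r+1}=0$, and process rows $i=r,\dots,1$. Processing row $i$ with $R$ the set of entries of row $i$ of $P$: (D) if $m_i-1\in R$, leave row $i$, $\alpha_i=\alpha_{i+1}$; (DR) else if $\alpha_{i+1}=1$ and $m_{i+1}\notin R$, replace $m_i$ in row $i$ of $P'$ by $m_{i+1}$, $\alpha_i=1$; otherwise let $x$ be the smallest $P'_{>i}$-ejectable value (current $P'$) with $m_{i+1}<x<m_i$: (IR) if $x$ exists replace $m_i$ by $x$, $\alpha_i=1$; (NR) else leave row $i$, $\alpha_i=0$. Output final $P'$ and $m$. -}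

module Defs where

open import Data.Nat using (ℕ; zero; suc; _+_; _∸_; _≤_; _<_; _⊓_; _≡ᵇ_; _<ᵇ_; _≤ᵇ_)
open import Data.Bool using (Bool; true; false; _∧_; _∨_; not; if_then_else_)
open import Data.Bool.ListAction using (any)
open import Data.List using (List; []; _∷_; _++_; length; map; concat; reverse; upTo; drop; take; filterᵇ; foldr)
open import Data.List.Relation.Unary.All using (All)
open import Data.List.Relation.Unary.Linked using (Linked)
open import Data.Maybe using (Maybe; just; nothing)
open import Data.Product using (_×_; _,_; proj₁; proj₂)
open import Data.Sum using (_⊎_)
open import Relation.Binary.PropositionalEquality using (_≡_)

-- Tableaux: a tableau is the list of its rows (row 1 first), each row
-- read left to right.  Rows and columns are indexed from 1.

Tableau : Set
Tableau = List (List ℕ)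

nth : List ℕ → ℕ → Maybe ℕ
nth []       _       = nothing
nth (x ∷ xs) zero    = just x
nth (x ∷ xs) (suc j) = nth xs j

-- row i (1-based) of P; the empty list if there is no such row
row : Tableau → ℕ → List ℕ
row []       _             = []
row (u ∷ P)  zero          = []
row (u ∷ P)  (suc zero)    = u
row (u ∷ P)  (suc (suc i)) = row P (suc i)

-- entry at (i , j) (1-based); 0 if the cell is not in P
entry : Tableau → ℕ → ℕ → ℕ
entry P i j with nth (row P i) (j ∸ 1)
... | just x  = x
... | nothing = 0

ColumnDecreasing : List ℕ → List ℕ → Set
ColumnDecreasing u v = ∀ j x y → nth u j ≡ just x → nth v j ≡ just y → y < x

NonEmpty : List ℕ → Set
NonEmpty []      = Data.Empty.⊥ where import Data.Empty
NonEmpty (_ ∷ _) = Data.Unit.⊤ where import Data.Unit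

Positive : ℕ → Set
Positive n = 1 ≤ n

record DecreasingTableau (P : Tableau) : Set where
  field
    rowsNonEmpty : All NonEmpty P
    shape        : Linked (λ u v → length v ≤ length u) P
    positive     : All (All Positive) P
    rowsDecr     : All (Linked (λ x y → y < x)) P
    colsDecr     : Linked ColumnDecreasing P

rowWord : Tableau → List ℕ
rowWord P = concat (reverse P)

data _≡H_ : List ℕ → List ℕ → Set where
  H-refl  : ∀ {w} → w ≡H w
  H-sym   : ∀ {w v} → w ≡H v → v ≡H w
  H-trans : ∀ {w v x} → w ≡H v → v ≡H x → w ≡H x
  H-idem  : ∀ u v j → (u ++ j ∷ j ∷ v) ≡H (u ++ j ∷ v)
  H-braid : ∀ u v j → (u ++ j ∷ suc j ∷ j ∷ v) ≡H (u ++ suc j ∷ j ∷ suc j ∷ v)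
  H-comm  : ∀ u v j k → (2 + j ≤ k ⊎ 2 + k ≤ j) → (u ++ j ∷ k ∷ v) ≡H (u ++ k ∷ j ∷ v)

Reduced : List ℕ → Set
Reduced w = ∀ v → v ≡H w → length w ≤ length v

record Removable (P : Tableau) (r c : ℕ) : Set where
  field
    r-pos    : 1 ≤ r
    r-bound  : r ≤ length P
    lastCell : length (row P r) ≡ c
    bottom   : length (row P (suc r)) < c

_∈ᵇ_ : ℕ → List ℕ → Bool
x ∈ᵇ u = any (λ y → y ≡ᵇ x) u

-- smallest entry of u strictly greater than x (0 if none)
smallestAbove : List ℕ → ℕ → ℕ
smallestAbove u x with foldr step nothing u
  where
  step : ℕ → Maybe ℕ → Maybe ℕ
  step y acc = if x <ᵇ y then (Data.Maybe.maybe (λ z → just (y ⊓ z)) (just y) acc) else acc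
    where import Data.Maybe
... | just z  = z
... | nothing = 0

replaceVal : ℕ → ℕ → List ℕ → List ℕ
replaceVal a b = map (λ y → if y ≡ᵇ a then b else y)

updRow : Tableau → ℕ → (List ℕ → List ℕ) → Tableau
updRow []      _             f = []
updRow (u ∷ P) zero          f = u ∷ P
updRow (u ∷ P) (suc zero)    f = f u ∷ P
updRow (u ∷ P) (suc (suc i)) f = u ∷ updRow P (suc i) f

removeEmptyRows : Tableau → Tableau
removeEmptyRows = filterᵇ (λ u → 1 ≤ᵇ length u)

deleteCell : Tableau → ℕ → ℕ → Tableau
deleteCell P r c = removeEmptyRows (updRow P r (take (c ∸ 1)))

-- bumping path of (r , c): mAt P r c k = m_{r-k}

mAt : Tableau → ℕ → ℕ → ℕ → ℕ
mAt P r c zero    = entry P r c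
mAt P r c (suc k) = smallestAbove (row P (r ∸ suc k)) (mAt P r c k)

bump : Tableau → ℕ → ℕ → ℕ → ℕ
bump P r c i = mAt P r c (r ∸ i)

ejectable : Tableau → ℕ → Bool
ejectable []      x = false
ejectable (u ∷ P) x = (x ∈ᵇ u) ∧ (not ((x ∸ 1) ∈ᵇ u) ∨ ejectable P (x ∸ 1))

firstTrue : (ℕ → Bool) → List ℕ → Maybe ℕ
firstTrue p []       = nothing
firstTrue p (x ∷ xs) = if p x then just x else firstTrue p xs

smallestEjectable : Tableau → ℕ → ℕ → Maybe ℕ
smallestEjectable T a b = firstTrue (ejectable T) (map (λ k → suc a + k) (upTo (b ∸ suc a)))

egStep : Tableau → (ℕ → ℕ) → ℕ → Tableau → Tableau
egStep P m i T =
  if (m i ∸ 1) ∈ᵇ row P i then T else updRow T i (replaceVal (m i) (m (suc i)))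

egLoop : Tableau → ℕ → ℕ → ℕ → Tableau
egLoop P r c zero    = deleteCell P r c
egLoop P r c (suc k) = egStep P (bump P r c) (r ∸ suc k) (egLoop P r c k)

egReverse : Tableau → ℕ → ℕ → Tableau × ℕ
egReverse P r c = egLoop P r c (r ∸ 1) , bump P r c 1

-- processing row i; m = path values (m_{r+1} = 0 in the α = 0 case);
-- state = (current P' , α_{i+1})
psiStep : Tableau → (ℕ → ℕ) → ℕ → Tableau × Bool → Tableau × Bool
psiStep P m i (T , α) =
  if (m i ∸ 1) ∈ᵇ R then (T , α)
  else if α ∧ not (m (suc i) ∈ᵇ R)
       then (updRow T i (replaceVal (m i) (m (suc i))) , true)
       else ejectCase (smallestEjectable (drop i T) (m (suc i)) (m i))
  where
  R = row P i
  ejectCase : Maybe ℕ → Tableau × Bool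
  ejectCase (just x) = (updRow T i (replaceVal (m i) x) , true)
  ejectCase nothing  = (T , false)

psiLoop : Tableau → (ℕ → ℕ) → ℕ → Tableau × Bool → ℕ → Tableau × Bool
psiLoop P m s st zero    = st
psiLoop P m s st (suc k) = psiStep P m (s ∸ k) (psiLoop P m s st k)

bump0 : Tableau → ℕ → ℕ → ℕ → ℕ
bump0 P r c i = if i ≡ᵇ suc r then 0 else bump P r c i

Ψ : Tableau → ℕ → ℕ → Bool → Tableau × ℕ
Ψ P r c true  = proj₁ (psiLoop P (bump P r c) (r ∸ 1) (deleteCell P r c , true) (r ∸ 1)) , bump P r c 1
Ψ P r c false = proj₁ (psiLoop P (bump0 P r c) r (P , false) r) , bump P r c 1

-- With α = 1 the two reverse insertions can differ only in a row i where m_i - 1 is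
-- absent and m_{i+1} is present: there Ψ falls back to (IR)/(NR) while Edelman–Greene
-- performs (DR).  Such a row cannot occur when row(P) is reduced.  If m_{i+1} sits in
-- row i, every larger entry of row i is at least m_{i+1} + 2, so m_{i+1} commutes to the
-- front of row i in row(P): the row word becomes (rows ≥ i+1) m_{i+1} ⋯.  By descending
-- induction along the bumping path such a word is impossible.  In row ℓ, write
-- m_ℓ = m; sliding the trailing m to the left through the entries of row ℓ smaller than m
-- either creates a factor m m (when m - 1 is not in row ℓ), contradicting reducedness,
-- or meets m (m-1) ⋯ m, where a braid move pushes m - 1 = m_{ℓ+1} out in front of
-- row ℓ, giving the same situation one row lower.  In row r the cell (r,c) is last, so
-- only the first alternative is possible.

module Submission where

open import Defs
open import Level using (0ℓ)
open import Data.Nat using (ℕ; zero; suc; pred; _+_; _∸_; _≤_; _<_; _>_; _⊓_; _≡ᵇ_; _<ᵇ_; z≤n; s≤s; z<s; s≤s⁻¹)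
open import Data.Nat.Properties
open import Data.Bool using (true; false; if_then_else_)
open import Data.List using (List; []; _∷_; _++_; length; concat; reverse; drop; take; foldr; [_])
open import Data.List.Properties using (length-++; ++-assoc; ++-identityʳ; concat-++; reverse-++; take++drop≡id)
open import Data.List.Relation.Unary.All using (All; []; _∷_; tabulate; lookup) renaming (map to All-map)
open import Data.List.Relation.Unary.Any using (here; there)
open import Data.List.Relation.Unary.Linked using (Linked; []; _∷_) renaming (tail to Linked-tail)
open import Data.List.Membership.Propositional using (_∈_; _∉_)
open import Data.List.Membership.Propositional.Properties using (∈-++⁺ʳ; ∈-++⁺ˡ)
open import Data.List.Membership.DecPropositional _≟_ using (_∈?_)
open import Data.Maybe using (Maybe; just; nothing; maybe; fromMaybe)
open import Data.Product using (_×_; _,_; proj₁; proj₂; ∃)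
open import Data.Sum using (_⊎_; inj₁; inj₂)
open import Data.Empty using (⊥-elim)
open import Relation.Nullary using (¬_; yes; no)
open import Relation.Nullary.Reflects using (Reflects; ofʸ; ofⁿ; fromEquivalence)
open import Relation.Binary using (IsEquivalence; Setoid)
open import Relation.Binary.PropositionalEquality
  using (_≡_; _≢_; refl; sym; trans; cong; subst; subst₂; module ≡-Reasoning)
import Relation.Binary.Reasoning.Setoid as SetoidReasoning

infix 4 _≈H_

_≈H_ : List ℕ → List ℕ → Set
w ≈H v = w ≡H v × length w ≡ length v

≈H-isEquivalence : IsEquivalence _≈H_
≈H-isEquivalence = record
  { refl  = H-refl , refl
  ; sym   = λ (p , l) → H-sym p , sym l
  ; trans = λ (p , l) (q , m) → H-trans p q , trans l m
  }

≈H-setoid : Setoid 0ℓ 0ℓ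
≈H-setoid = record { isEquivalence = ≈H-isEquivalence }

open IsEquivalence ≈H-isEquivalence using () renaming (reflexive to ≈H-reflexive)
module ≈H-Reasoning = SetoidReasoning ≈H-setoid

≡H-++-congˡ : ∀ a {w v} → w ≡H v → (a ++ w) ≡H (a ++ v)
≡H-++-congˡ a H-refl               = H-refl
≡H-++-congˡ a (H-sym p)            = H-sym (≡H-++-congˡ a p)
≡H-++-congˡ a (H-trans p q)        = H-trans (≡H-++-congˡ a p) (≡H-++-congˡ a q)
≡H-++-congˡ a (H-idem u v j)       = subst₂ _≡H_ (++-assoc a u _) (++-assoc a u _) (H-idem (a ++ u) v j)
≡H-++-congˡ a (H-braid u v j)      = subst₂ _≡H_ (++-assoc a u _) (++-assoc a u _) (H-braid (a ++ u) v j)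
≡H-++-congˡ a (H-comm u v j k far) = subst₂ _≡H_ (++-assoc a u _) (++-assoc a u _) (H-comm (a ++ u) v j k far)

≈H-++-congˡ : ∀ a {w v} → w ≈H v → a ++ w ≈H a ++ v
≈H-++-congˡ a {w} {v} (p , l) = ≡H-++-congˡ a p , (begin
  length (a ++ w)     ≡⟨ length-++ a ⟩
  length a + length w ≡⟨ cong (length a +_) l ⟩
  length a + length v ≡⟨ length-++ a ⟨
  length (a ++ v)     ∎)
  where open ≡-Reasoning

Far : ℕ → ℕ → Set
Far j k = 2 + j ≤ k ⊎ 2 + k ≤ j

commute : ∀ {j k} v → Far j k → j ∷ k ∷ v ≈H k ∷ j ∷ v
commute v far = H-comm [] v _ _ far , refl

braid : ∀ j v → suc j ∷ j ∷ suc j ∷ v ≈H j ∷ suc j ∷ j ∷ v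
braid j v = H-sym (H-braid [] v j) , refl

commute-past : ∀ x L v → All (λ y → Far y x) L → L ++ x ∷ v ≈H x ∷ L ++ v
commute-past x []      v []         = ≈H-reflexive refl
commute-past x (y ∷ L) v (far ∷ fs) = begin
  y ∷ L ++ x ∷ v ≈⟨ ≈H-++-congˡ [ y ] (commute-past x L v fs) ⟩
  y ∷ x ∷ L ++ v ≈⟨ commute (L ++ v) far ⟩
  x ∷ y ∷ L ++ v ∎
  where open ≈H-Reasoning

Reduced⇒¬≈H-square : ∀ {w} → Reduced w → ∀ X m Y → ¬ w ≈H X ++ m ∷ m ∷ Y
Reduced⇒¬≈H-square red X m Y (w≡H , |w|≡) =
  ≤⇒≯ (red (X ++ m ∷ Y) (H-trans (H-sym (H-idem X Y m)) (H-sym w≡H))) shorter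
  where
  shorter : length (X ++ m ∷ Y) < _
  shorter = subst₂ _<_ (sym (length-++ X)) (trans (sym (length-++ X)) (sym |w|≡))
                   (+-monoʳ-< (length X) (n<1+n _))

Decreasing : List ℕ → Set
Decreasing = Linked _>_

Decreasing-head> : ∀ {x xs y} → Decreasing (x ∷ xs) → y ∈ xs → y < x
Decreasing-head> (x>y ∷ _) (here refl)  = x>y
Decreasing-head> (x>y ∷ d) (there y∈ys) = <-trans (Decreasing-head> d y∈ys) x>y

far-below : ∀ {y m} → y < m → y ≢ m ∸ 1 → Far y m
far-below {m = suc m} (s≤s y≤m) y≢m = inj₁ (s≤s (≤∧≢⇒< y≤m y≢m))

slide-into-square : ∀ m tl B → Decreasing (m ∷ tl) → m ∸ 1 ∉ tl →
                    m ∷ tl ++ m ∷ B ≈H m ∷ m ∷ tl ++ B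
slide-into-square m tl B dec m-1∉tl = ≈H-++-congˡ [ m ] (commute-past m tl B (tabulate λ y∈tl →
  far-below (Decreasing-head> dec y∈tl) (λ y≡m-1 → m-1∉tl (subst (_∈ tl) y≡m-1 y∈tl))))

-- In  pre (m (m-1) t') m B  the trailing m moves left to a braid  m (m-1) m  whose
-- middle letter then passes through pre.
braid-out : ∀ m pre tl B → All (m <_) pre → Decreasing (m ∷ tl) → m ∸ 1 ∈ tl →
            ∃ λ B′ → pre ++ m ∷ tl ++ m ∷ B ≈H m ∸ 1 ∷ B′
braid-out zero    pre (y ∷ t) B _ (() ∷ _) _
braid-out (suc n) pre (y ∷ t) B _ (y≤n ∷ dec) (there n∈t) =
  ⊥-elim (≤⇒≯ (s≤s⁻¹ y≤n) (Decreasing-head> dec n∈t))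
braid-out (suc n) pre (n ∷ t) B pre>m (_ ∷ dec) (here refl) = pre ++ suc n ∷ n ∷ t ++ B , (begin
  pre ++ suc n ∷ n ∷ t ++ suc n ∷ B ≈⟨ ≈H-++-congˡ pre (≈H-++-congˡ (suc n ∷ [ n ])
                                         (commute-past (suc n) t B (tabulate λ y∈t →
                                           inj₁ (s≤s (Decreasing-head> dec y∈t))))) ⟩
  pre ++ suc n ∷ n ∷ suc n ∷ t ++ B ≈⟨ ≈H-++-congˡ pre (braid n (t ++ B)) ⟩
  pre ++ n ∷ suc n ∷ n ∷ t ++ B     ≈⟨ commute-past n pre _ (All-map inj₂ pre>m) ⟩
  n ∷ pre ++ suc n ∷ n ∷ t ++ B     ∎)
  where open ≈H-Reasoning

∈ᵇ-reflects-∈ : ∀ x u → Reflects (x ∈ u) (x ∈ᵇ u)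
∈ᵇ-reflects-∈ x []      = ofⁿ λ ()
∈ᵇ-reflects-∈ x (y ∷ u) with y ≡ᵇ x | fromEquivalence (≡ᵇ⇒≡ y x) (≡⇒≡ᵇ y x)
... | true  | ofʸ y≡x = ofʸ (here (sym y≡x))
... | false | ofⁿ y≢x = there-reflects (∈ᵇ-reflects-∈ x u)
  where
  there-reflects : ∀ {b} → Reflects (x ∈ u) b → Reflects (x ∈ y ∷ u) b
  there-reflects (ofʸ x∈u) = ofʸ (there x∈u)
  there-reflects (ofⁿ x∉u) = ofⁿ λ { (here refl) → y≢x refl ; (there x∈u) → x∉u x∈u }

-- the fold behind smallestAbove, whose step function is local to it
minAbove : ℕ → List ℕ → Maybe ℕ
minAbove x = foldr (λ y acc → if x <ᵇ y then maybe (λ z → just (y ⊓ z)) (just y) acc else acc) nothing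

smallestAbove≡ : ∀ u x → smallestAbove u x ≡ fromMaybe 0 (minAbove x u)
smallestAbove≡ u x with minAbove x u
... | just _  = refl
... | nothing = refl

record IsMinAbove (x : ℕ) (u : List ℕ) (z : ℕ) : Set where
  field
    member : z ∈ u
    above  : x < z
    least  : ∀ {y} → y ∈ u → x < y → z ≤ y

open IsMinAbove

data MinAboveView (x : ℕ) (u : List ℕ) : Maybe ℕ → Set where
  none : (∀ {y} → y ∈ u → ¬ x < y) → MinAboveView x u nothing
  some : ∀ {z} → IsMinAbove x u z → MinAboveView x u (just z)

IsMinAbove-here : ∀ {x y u} → x < y → (∀ {v} → v ∈ u → ¬ x < v) → IsMinAbove x (y ∷ u) y
IsMinAbove-here x<y ∄ = record
  { member = here refl
  ; above  = x<y
  ; least  = λ { (here refl) _ → ≤-refl ; (there v∈u) x<v → ⊥-elim (∄ v∈u x<v) }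
  }

IsMinAbove-there : ∀ {x y u z} → ¬ x < y → IsMinAbove x u z → IsMinAbove x (y ∷ u) z
IsMinAbove-there x≮y m = record
  { member = there (member m)
  ; above  = above m
  ; least  = λ { (here refl) x<y → ⊥-elim (x≮y x<y) ; (there v∈u) x<v → least m v∈u x<v }
  }

IsMinAbove-⊓ : ∀ {x y u z} → x < y → IsMinAbove x u z → IsMinAbove x (y ∷ u) (y ⊓ z)
IsMinAbove-⊓ {x} {y} {u} {z} x<y m = record
  { member = member-⊓ (⊓-sel y z)
  ; above  = ⊓-glb x<y (above m)
  ; least  = λ { (here refl) _ → m⊓n≤m y z ; (there v∈u) x<v → ≤-trans (m⊓n≤n y z) (least m v∈u x<v) }
  }
  where
  member-⊓ : y ⊓ z ≡ y ⊎ y ⊓ z ≡ z → y ⊓ z ∈ y ∷ u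
  member-⊓ (inj₁ ≡y) = here ≡y
  member-⊓ (inj₂ ≡z) = there (subst (_∈ u) (sym ≡z) (member m))

minAbove-view : ∀ x u → MinAboveView x u (minAbove x u)
minAbove-view x []      = none λ ()
minAbove-view x (y ∷ u) with x <ᵇ y | <ᵇ-reflects-< x y | minAbove x u | minAbove-view x u
... | false | ofⁿ x≮y | _ | none ∄ = none λ { (here refl) → x≮y ; (there v∈u) → ∄ v∈u }
... | false | ofⁿ x≮y | _ | some m = some (IsMinAbove-there x≮y m)
... | true  | ofʸ x<y | _ | none ∄ = some (IsMinAbove-here x<y ∄)
... | true  | ofʸ x<y | _ | some m = some (IsMinAbove-⊓ x<y m)

smallestAbove-isMin : ∀ {u x y} → y ∈ u → x < y → IsMinAbove x u (smallestAbove u x)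
smallestAbove-isMin {u} {x} y∈u x<y rewrite smallestAbove≡ u x with minAbove x u | minAbove-view x u
... | nothing | none ∄ = ⊥-elim (∄ y∈u x<y)
... | just _  | some m = m

IsMinAbove-pred : ∀ {x u z} → IsMinAbove x u z → z ∸ 1 ∈ u → x ≡ z ∸ 1
IsMinAbove-pred {x} {z = suc n} m n∈u =
  ≤-antisym (s≤s⁻¹ (above m)) (≮⇒≥ λ x<n → ≤⇒≯ (least m n∈u x<n) (n<1+n n))

IsMinAbove⇒suc∉ : ∀ {x u z} → IsMinAbove x u z → z ∸ 1 ∉ u → x ∈ u → suc x ∉ u
IsMinAbove⇒suc∉ {x} {u} m z-1∉u x∈u sx∈u =
  z-1∉u (subst (_∈ u) (cong (_∸ 1) (sym (≤-antisym (least m sx∈u ≤-refl) (above m)))) x∈u)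

nth⇒<length : ∀ u p {x} → nth u p ≡ just x → p < length u
nth⇒<length (y ∷ u) zero    _ = s≤s z≤n
nth⇒<length (y ∷ u) (suc p) e = s≤s (nth⇒<length u p e)

<length⇒nth : ∀ u p → p < length u → ∃ λ x → nth u p ≡ just x
<length⇒nth (y ∷ u) zero    _       = y , refl
<length⇒nth (y ∷ u) (suc p) (s≤s q) = <length⇒nth u p q

nth⇒∈ : ∀ u p {x} → nth u p ≡ just x → x ∈ u
nth⇒∈ (y ∷ u) zero    refl = here refl
nth⇒∈ (y ∷ u) (suc p) e    = there (nth⇒∈ u p e)

∈⇒nth : ∀ {u x} → x ∈ u → ∃ λ p → nth u p ≡ just x
∈⇒nth (here refl) = zero , refl
∈⇒nth (there x∈u) with p , e ← ∈⇒nth x∈u = suc p , e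

record Split (u : List ℕ) (p x : ℕ) : Set where
  field
    before after : List ℕ
    u≡           : u ≡ before ++ x ∷ after
    before>x     : All (x <_) before
    decreasing   : Decreasing (x ∷ after)
    |before|≡p   : length before ≡ p

open Split

before⊆ : ∀ {u p x y} (s : Split u p x) → y ∈ before s → y ∈ u
before⊆ s y∈ = subst (_ ∈_) (sym (u≡ s)) (∈-++⁺ˡ y∈)

after⊆ : ∀ {u p x y} (s : Split u p x) → y ∈ after s → y ∈ u
after⊆ s y∈ = subst (_ ∈_) (sym (u≡ s)) (∈-++⁺ʳ (before s) (there y∈))

split-decreasing : ∀ {u p x} → Decreasing u → nth u p ≡ just x → Split u p x
split-decreasing {y ∷ u} {zero}  dec refl = record
  { before = [] ; after = u ; u≡ = refl ; before>x = [] ; decreasing = dec ; |before|≡p = refl }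
split-decreasing {y ∷ u} {suc p} dec e = record
  { before     = y ∷ before s
  ; after      = after s
  ; u≡         = cong (y ∷_) (u≡ s)
  ; before>x   = Decreasing-head> dec (nth⇒∈ u p e) ∷ before>x s
  ; decreasing = decreasing s
  ; |before|≡p = cong suc (|before|≡p s)
  }
  where s = split-decreasing (Linked-tail dec) e

row-decreasing : ∀ P i → All Decreasing P → Decreasing (row P i)
row-decreasing []      i             _          = []
row-decreasing (u ∷ P) zero          _          = []
row-decreasing (u ∷ P) (suc zero)    (dec ∷ _)  = dec
row-decreasing (u ∷ P) (suc (suc i)) (_ ∷ decs) = row-decreasing P (suc i) decs

column-step : ∀ {P} i p {x} → Linked ColumnDecreasing P → Linked (λ u v → length v ≤ length u) P →
              1 ≤ i → nth (row P (suc i)) p ≡ just x → ∃ λ y → nth (row P i) p ≡ just y × x < y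
column-step {u ∷ v ∷ P} (suc zero) p (cd ∷ _) (sh ∷ _) _ e
  with y , ey ← <length⇒nth u p (<-≤-trans (nth⇒<length v p e) sh) = y , ey , cd p y _ ey e
column-step {u ∷ v ∷ P} (suc (suc i)) p (_ ∷ cds) (_ ∷ shs) _ e = column-step {v ∷ P} (suc i) p cds shs z<s e
column-step {[]}        (suc i) p _ _ _ ()
column-step {_ ∷ []}    (suc i) p _ _ _ ()

entry-nth : ∀ P i j {y} → nth (row P i) (j ∸ 1) ≡ just y → entry P i j ≡ y
entry-nth P i j e with nth (row P i) (j ∸ 1) | e
... | just _ | refl = refl

rowWord-++ : ∀ P Q → rowWord (P ++ Q) ≡ rowWord Q ++ rowWord P
rowWord-++ P Q = trans (cong concat (reverse-++ P Q)) (sym (concat-++ (reverse Q) (reverse P)))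

rowWord-drop-pred : ∀ P i → 1 ≤ i → i ≤ length P → rowWord (drop (pred i) P) ≡ rowWord (drop i P) ++ row P i
rowWord-drop-pred (u ∷ P) (suc zero) _ _ = begin
  rowWord ([ u ] ++ P)          ≡⟨ rowWord-++ [ u ] P ⟩
  rowWord P ++ u ++ []          ≡⟨ cong (rowWord P ++_) (++-identityʳ u) ⟩
  rowWord P ++ u                ∎
  where open ≡-Reasoning
rowWord-drop-pred (u ∷ P) (suc (suc i)) _ (s≤s i<) = rowWord-drop-pred P (suc i) z<s i<

rowWord-around : ∀ P i → 1 ≤ i → i ≤ length P →
                 rowWord P ≡ rowWord (drop i P) ++ row P i ++ rowWord (take (pred i) P)
rowWord-around P i 1≤i i≤ = begin
  rowWord P                                                ≡⟨ cong rowWord (take++drop≡id (pred i) P) ⟨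
  rowWord (take (pred i) P ++ drop (pred i) P)             ≡⟨ rowWord-++ (take (pred i) P) _ ⟩
  rowWord (drop (pred i) P) ++ rowWord (take (pred i) P)   ≡⟨ cong (_++ rowWord (take (pred i) P)) (rowWord-drop-pred P i 1≤i i≤) ⟩
  (rowWord (drop i P) ++ row P i) ++ rowWord (take (pred i) P) ≡⟨ ++-assoc (rowWord (drop i P)) _ _ ⟩
  rowWord (drop i P) ++ row P i ++ rowWord (take (pred i) P) ∎
  where open ≡-Reasoning

psiStep≡egStep : ∀ P (m : ℕ → ℕ) i T → (m i ∸ 1 ∉ row P i → m (suc i) ∉ row P i) →
                 psiStep P m i (T , true) ≡ (egStep P m i T , true)
psiStep≡egStep P m i T key with (m i ∸ 1) ∈ᵇ row P i | ∈ᵇ-reflects-∈ (m i ∸ 1) (row P i)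
... | true  | _        = refl
... | false | ofⁿ m-1∉ with m (suc i) ∈ᵇ row P i | ∈ᵇ-reflects-∈ (m (suc i)) (row P i)
...   | false | _       = refl
...   | true  | ofʸ m∈  = ⊥-elim (key m-1∉ m∈)

-- The bumping path of a removable cell; M k = m_{r-k} lies in row r - k

∸-suc : ∀ {m n} → n < m → m ∸ n ≡ suc (m ∸ suc n)
∸-suc {suc m} (s≤s n≤m) = +-∸-assoc 1 n≤m

module BumpingPath (P : Tableau) (r c : ℕ) (dt : DecreasingTableau P) (rem : Removable P r c) where
  open DecreasingTableau dt
  open Removable rem

  M : ℕ → ℕ
  M = mAt P r c

  rows-decreasing : ∀ i → Decreasing (row P i)
  rows-decreasing i = row-decreasing P i rowsDecr

  path-row-bounds : ∀ {k} → k < r → 1 ≤ r ∸ k × r ∸ k ≤ length P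
  path-row-bounds {k} k<r = m<n⇒0<n∸m k<r , ≤-trans (m∸n≤m r k) r-bound

  c≥1 : 1 ≤ c
  c≥1 = ≤-<-trans z≤n bottom

  last-cell : nth (row P r) (c ∸ 1) ≡ just (M 0)
  last-cell with y , e ← <length⇒nth (row P r) (c ∸ 1) (subst (c ∸ 1 <_) (sym lastCell) (∸-monoʳ-< z<s c≥1))
    rewrite entry-nth P r c e = e

  path-position : ∀ k → k < r → ∃ λ p → nth (row P (r ∸ k)) p ≡ just (M k)
  path-step     : ∀ k → suc k < r → IsMinAbove (M k) (row P (r ∸ suc k)) (M (suc k))

  path-position zero    _    = c ∸ 1 , last-cell
  path-position (suc k) sk<r = ∈⇒nth (member (path-step k sk<r))

  path-step k sk<r
    with p , e ← path-position k (<⇒≤ sk<r)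
    with y , ey , Mk<y ← column-step (r ∸ suc k) p colsDecr shape (m<n⇒0<n∸m sk<r)
                           (subst (λ i → nth (row P i) p ≡ just (M k)) (∸-suc (<⇒≤ sk<r)) e)
    = smallestAbove-isMin (nth⇒∈ _ p ey) Mk<y

  path-split : ∀ k (k<r : k < r) → Split (row P (r ∸ k)) (proj₁ (path-position k k<r)) (M k)
  path-split k k<r = split-decreasing (rows-decreasing (r ∸ k)) (proj₂ (path-position k k<r))

  unfold-row : ∀ k (k<r : k < r) B → let s = path-split k k<r in
    rowWord (drop (r ∸ suc k) P) ++ M k ∷ B ≡ rowWord (drop (r ∸ k) P) ++ before s ++ M k ∷ after s ++ M k ∷ B
  unfold-row k k<r B = begin
    rowWord (drop (r ∸ suc k) P) ++ M k ∷ B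
      ≡⟨ cong (λ i → rowWord (drop i P) ++ M k ∷ B) (pred[m∸n]≡m∸[1+n] r k) ⟨
    rowWord (drop (pred (r ∸ k)) P) ++ M k ∷ B
      ≡⟨ cong (_++ M k ∷ B) (rowWord-drop-pred P (r ∸ k) 1≤i i≤) ⟩
    (X ++ row P (r ∸ k)) ++ M k ∷ B
      ≡⟨ cong (λ u → (X ++ u) ++ M k ∷ B) (u≡ s) ⟩
    (X ++ before s ++ M k ∷ after s) ++ M k ∷ B
      ≡⟨ ++-assoc X _ _ ⟩
    X ++ (before s ++ M k ∷ after s) ++ M k ∷ B
      ≡⟨ cong (X ++_) (++-assoc (before s) _ _) ⟩
    X ++ before s ++ M k ∷ after s ++ M k ∷ B ∎
    where
    open ≡-Reasoning
    s = path-split k k<r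
    X = rowWord (drop (r ∸ k) P)
    1≤i = proj₁ (path-row-bounds k<r)
    i≤  = proj₂ (path-row-bounds k<r)

  module _ (red : Reduced (rowWord P)) where

    path-letter-cannot-follow-its-row :
      ∀ k → k < r → ∀ B → ¬ rowWord P ≈H rowWord (drop (r ∸ suc k) P) ++ M k ∷ B
    predecessor-in-row-impossible :
      ∀ k (k<r : k < r) B → rowWord P ≈H rowWord (drop (r ∸ suc k) P) ++ M k ∷ B →
      ¬ M k ∸ 1 ∈ after (path-split k k<r)

    path-letter-cannot-follow-its-row k k<r B h with M k ∸ 1 ∈? after (path-split k k<r)
    ... | yes m-1∈ = predecessor-in-row-impossible k k<r B h m-1∈
    ... | no  m-1∉ = Reduced⇒¬≈H-square red (X ++ before s) (M k) (after s ++ B) (begin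
      rowWord P                                  ≈⟨ h ⟩
      rowWord (drop (r ∸ suc k) P) ++ M k ∷ B    ≡⟨ unfold-row k k<r B ⟩
      X ++ before s ++ M k ∷ after s ++ M k ∷ B  ≈⟨ ≈H-++-congˡ X (≈H-++-congˡ (before s)
                                                      (slide-into-square (M k) (after s) B (decreasing s) m-1∉)) ⟩
      X ++ before s ++ M k ∷ M k ∷ after s ++ B  ≡⟨ ++-assoc X (before s) _ ⟨
      (X ++ before s) ++ M k ∷ M k ∷ after s ++ B ∎)
      where
      open ≈H-Reasoning
      s = path-split k k<r
      X = rowWord (drop (r ∸ k) P)

    -- (r , c) is the last cell of row r, so nothing follows m_r there
    predecessor-in-row-impossible zero k<r B h m-1∈ = no-tail (after s) |after|≡0 m-1∈
      where
      s = path-split zero k<r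
      no-tail : ∀ {x} tl → length tl ≡ 0 → ¬ x ∈ tl
      no-tail [] _ ()
      |after|≡0 : length (after s) ≡ 0
      |after|≡0 = suc-injective (+-cancelˡ-≡ (c ∸ 1) _ _ (begin
        c ∸ 1 + suc (length (after s))         ≡⟨ cong (_+ length (M 0 ∷ after s)) (|before|≡p s) ⟨
        length (before s) + length (M 0 ∷ after s) ≡⟨ length-++ (before s) ⟨
        length (before s ++ M 0 ∷ after s)     ≡⟨ cong length (u≡ s) ⟨
        length (row P r)                       ≡⟨ lastCell ⟩
        c                                      ≡⟨ m∸n+n≡m c≥1 ⟨
        c ∸ 1 + 1                              ∎))
        where open ≡-Reasoning
    predecessor-in-row-impossible (suc k) sk<r B h m-1∈ =
      path-letter-cannot-follow-its-row k (<⇒≤ sk<r) B′ (begin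
        rowWord P                                          ≈⟨ h ⟩
        rowWord (drop (r ∸ suc (suc k)) P) ++ M (suc k) ∷ B ≡⟨ unfold-row (suc k) sk<r B ⟩
        X ++ before s ++ M (suc k) ∷ after s ++ M (suc k) ∷ B ≈⟨ ≈H-++-congˡ X (proj₂ out) ⟩
        X ++ M (suc k) ∸ 1 ∷ B′                            ≡⟨ cong (λ m → X ++ m ∷ B′) Mk≡ ⟨
        X ++ M k ∷ B′                                      ∎)
      where
      open ≈H-Reasoning
      s = path-split (suc k) sk<r
      X = rowWord (drop (r ∸ suc k) P)
      out = braid-out (M (suc k)) (before s) (after s) B (before>x s) (decreasing s) m-1∈
      B′ = proj₁ out
      Mk≡ : M k ≡ M (suc k) ∸ 1
      Mk≡ = IsMinAbove-pred (path-step k sk<r)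
              (after⊆ s m-1∈)

    -- If m_{i+1} were in row i, all larger entries of row i would exceed it by at least 2.
    predecessor-absent⇒path-letter-absent :
      ∀ k → suc k < r → M (suc k) ∸ 1 ∉ row P (r ∸ suc k) → M k ∉ row P (r ∸ suc k)
    predecessor-absent⇒path-letter-absent k sk<r m-1∉ Mk∈ =
      path-letter-cannot-follow-its-row k (<⇒≤ sk<r) (before s ++ after s ++ U) (begin
        rowWord P                             ≡⟨ rowWord-around P i (proj₁ bounds) (proj₂ bounds) ⟩
        X ++ row P i ++ U                     ≡⟨ cong (λ u → X ++ u ++ U) (u≡ s) ⟩
        X ++ (before s ++ M k ∷ after s) ++ U ≡⟨ cong (X ++_) (++-assoc (before s) _ U) ⟩
        X ++ before s ++ M k ∷ after s ++ U   ≈⟨ ≈H-++-congˡ X (commute-past (M k) (before s) (after s ++ U)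
                                                   (tabulate far-above)) ⟩
        X ++ M k ∷ before s ++ after s ++ U   ∎)
      where
      open ≈H-Reasoning
      i = r ∸ suc k
      bounds = path-row-bounds sk<r
      X = rowWord (drop i P)
      U = rowWord (take (pred i) P)
      s = split-decreasing (rows-decreasing i) (proj₂ (∈⇒nth Mk∈))
      sMk∉ : suc (M k) ∉ row P i
      sMk∉ = IsMinAbove⇒suc∉ (path-step k sk<r) m-1∉ Mk∈
      far-above : ∀ {y} → y ∈ before s → Far y (M k)
      far-above y∈ = inj₂ (≤∧≢⇒< (lookup (before>x s) y∈)
                                 λ sMk≡y → sMk∉ (subst (_∈ row P i) (sym sMk≡y) (before⊆ s y∈)))

    psiLoop≡egLoop : ∀ k → k < r →
      psiLoop P (bump P r c) (r ∸ 1) (deleteCell P r c , true) k ≡ (egLoop P r c k , true)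
    psiLoop≡egLoop zero    _    = refl
    psiLoop≡egLoop (suc k) sk<r rewrite psiLoop≡egLoop k (<⇒≤ sk<r) | ∸-+-assoc r 1 k =
      psiStep≡egStep P (bump P r c) (r ∸ suc k) (egLoop P r c k)
        (subst₂ (λ a b → a ∸ 1 ∉ row P (r ∸ suc k) → b ∉ row P (r ∸ suc k))
          (sym (bump-on-path (suc k) sk<r)) (sym bump-next)
          (predecessor-absent⇒path-letter-absent k sk<r))
      where
      bump-on-path : ∀ j → j < r → bump P r c (r ∸ j) ≡ M j
      bump-on-path j j<r = cong M (m∸[m∸n]≡n (<⇒≤ j<r))
      bump-next : bump P r c (suc (r ∸ suc k)) ≡ M k
      bump-next = trans (cong (bump P r c) (sym (∸-suc (<⇒≤ sk<r)))) (bump-on-path k (<⇒≤ sk<r))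

lemma3p6 : (P : Tableau) (r c : ℕ) →
    DecreasingTableau P → Reduced (rowWord P) → Removable P r c →
    Ψ P r c true ≡ egReverse P r c
lemma3p6 P r c dt red rem =
  cong (λ st → proj₁ st , bump P r c 1) (psiLoop≡egLoop red (r ∸ 1) (∸-monoʳ-< z<s r-pos))
  where
  open BumpingPath P r c dt rem
  open Removable rem
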